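{- Let $X$ be a finite non-empty set equipped with the discrete topology, and give $X^\omega$ the product topology. For $S \subseteq X^\omega$, the following are equivalent: (1) $S$ is of second category in $X^\omega$; (2) for each function $f:\omega\rightarrow\bigcup_{n\in\omega}X^n$ there exists a sequence $\{a_n\}_{n\in\omega}$ belonging to $S$ such that for infinitely many $i\in\omega$ the infinite sequence $\{a_{i+n}\}_{n\in\omega}$ extends the finite sequence $f(i)$.
   Context: $\omega$ denotes the set of natural numbers $\{0,1,2,\dots\}$, and $X^n$ is the set of finite sequences of length $n$ of elements of $X$. An infinite sequence $\{b_n\}_{n\in\omega}$ extends a finite sequence $(c_0,\dots,c_{m-1})\in X^m$ if $b_j=c_j$ for all $j<m$. A set is of second category if it is not of first category (not a countable union of nowhere dense sets). -}

module Defs where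

open import Data.Nat using (ℕ; _≤_; _<_)
open import Data.Fin using (Fin; toℕ)
open import Data.List using (List; length; lookup)
open import Data.Product using (Σ; _×_; ∃; _,_)
open import Relation.Nullary using (¬_)
open import Relation.Binary.PropositionalEquality using (_≡_)

Seq : Set → Set
Seq X = ℕ → X

Subset : Set → Set₁
Subset X = Seq X → Set

_⊆_ : {X : Set} → Subset X → Subset X → Set
A ⊆ B = ∀ x → A x → B x

Extends : {X : Set} → Seq X → List X → Set
Extends b c = (j : Fin (length c)) → b (toℕ j) ≡ lookup c j

shift : {X : Set} → ℕ → Seq X → Seq X
shift i a n = a (i Data.Nat.+ n)

AgreeUpTo : {X : Set} → ℕ → Seq X → Seq X → Set
AgreeUpTo n a b = ∀ j → j < n → a j ≡ b j

-- Product topology with X discrete: U is open iff every point of U has a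
-- basic cylinder neighbourhood (agreement on finitely many initial coordinates)
-- contained in U.
IsOpen : {X : Set} → Subset X → Set
IsOpen U = ∀ a → U a → ∃ λ n → ∀ b → AgreeUpTo n a b → U b

Closure : {X : Set} → Subset X → Subset X
Closure A x = ∀ n → ∃ λ a → A a × AgreeUpTo n x a

-- Nowhere dense: the closure has empty interior, i.e. every open set
-- contained in the closure is empty.
NowhereDense : {X : Set} → Subset X → Set₁
NowhereDense A = ∀ U → IsOpen U → U ⊆ Closure A → ∀ x → ¬ U x

-- First category: a countable union of nowhere dense sets
-- (equivalently, contained in one, since subsets of nowhere dense sets are
-- nowhere dense).
FirstCategory : {X : Set} → Subset X → Set₁
FirstCategory {X} S =
  Σ (ℕ → Subset X) λ N → (∀ k → NowhereDense (N k)) × (S ⊆ λ x → ∃ λ k → N k x)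

SecondCategory : {X : Set} → Subset X → Set₁
SecondCategory S = ¬ FirstCategory S

InfinitelyMany : (ℕ → Set) → Set
InfinitelyMany P = ∀ m → ∃ λ i → m ≤ i × P i

Condition2 : {X : Set} → Subset X → Set
Condition2 {X} S = (f : ℕ → List X) →
  ∃ λ a → S a × InfinitelyMany (λ i → Extends (shift i a) (f i))

-- (1) ⇒ (2): if no point of S extends f(i) at infinitely many offsets i, then S is covered by
-- the sets N_m of sequences extending no f(i) at an offset i ≥ m, and each N_m is nowhere
-- dense, since every cylinder is refined by writing f(i) at an offset i beyond its length.
-- (2) ⇒ (1): given nowhere dense sets N_0, N_1, …, choose for every i a word f(i) such that,
-- whatever the first i coordinates are (finitely many choices, as X is finite), continuing
-- them with f(i) leads into a cylinder missing N_0, …, N_i; the word is built by refining it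
-- once for each of these finitely many constraints. A point of S that extends f(i) at some
-- offset i ≥ k then lies outside N_k, so S is not covered by the N_k.
module Submission where

open import Defs
open import Data.Nat using (ℕ; suc)
open import Data.Fin using (Fin)
open import Function.Bundles using (_↔_; _⇔_)
open import Axiom.ExcludedMiddle using (ExcludedMiddle)
open import Level using (0ℓ)

open import Axiom.DoubleNegationElimination using (DoubleNegationElimination; em⇒dne)
open import Data.Fin using (toℕ) renaming (zero to fzero; suc to fsuc)
open import Data.Fin.Properties using (toℕ<n)
open import Data.List
  using (List; []; _∷_; [_]; length; map; applyUpTo; upTo; allFin; cartesianProduct; cartesianProductWith)
open import Data.List.Membership.Propositional using (_∈_)
open import Data.List.Membership.Propositional.Properties
  using (∈-map⁺; ∈-allFin; ∈-upTo⁺; ∈-cartesianProduct⁺; ∈-cartesianProductWith⁺)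
open import Data.List.Relation.Unary.Any using (here; there)
open import Data.Nat using (zero; _+_; _≤_; z≤n; s≤s)
open import Data.Nat.Properties
  using (≤-refl; ≤-trans; <-≤-trans; m≤m+n; m≤n+m; +-monoʳ-<)
open import Data.Product using (∃; ∃₂; _×_; _,_; proj₁; proj₂)
open import Function.Bundles using (Inverse; mk⇔)
open import Relation.Nullary using (¬_)
open import Relation.Binary.PropositionalEquality using (_≗_; refl; sym; trans; subst)

private variable
  X : Set
  i l m n : ℕ
  a b c : Seq X

_++ˢ_ : List X → Seq X → Seq X
([] ++ˢ s) j = s j
((x ∷ w) ++ˢ s) zero = x
((x ∷ w) ++ˢ s) (suc j) = (w ++ˢ s) j

splice : ℕ → Seq X → Seq X → Seq X
splice i p s = applyUpTo p i ++ˢ s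

agreeUpTo-sym : AgreeUpTo n a b → AgreeUpTo n b a
agreeUpTo-sym a≈b j j<n = sym (a≈b j j<n)

agreeUpTo-trans : AgreeUpTo n a b → AgreeUpTo n b c → AgreeUpTo n a c
agreeUpTo-trans a≈b b≈c j j<n = trans (a≈b j j<n) (b≈c j j<n)

agreeUpTo-weaken : m ≤ n → AgreeUpTo n a b → AgreeUpTo m a b
agreeUpTo-weaken m≤n a≈b j j<m = a≈b j (<-≤-trans j<m m≤n)

agreeUpTo-shift : ∀ i → AgreeUpTo (i + l) a b → AgreeUpTo l (shift i a) (shift i b)
agreeUpTo-shift i a≈b j j<l = a≈b (i + j) (+-monoʳ-< i j<l)

agreeUpTo-+ : ∀ i → AgreeUpTo i a b → AgreeUpTo l (shift i a) (shift i b) →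
              AgreeUpTo (i + l) a b
agreeUpTo-+ zero    _   tail≈ = tail≈
agreeUpTo-+ (suc i) a≈b tail≈ zero    _         = a≈b zero (s≤s z≤n)
agreeUpTo-+ (suc i) a≈b tail≈ (suc j) (s≤s j<n) =
  agreeUpTo-+ i (λ j′ j′<i → a≈b (suc j′) (s≤s j′<i)) tail≈ j j<n

agreeUpTo-splice : ∀ i (p s : Seq X) → AgreeUpTo i p (splice i p s)
agreeUpTo-splice (suc i) p s zero    _         = refl
agreeUpTo-splice (suc i) p s (suc j) (s≤s j<i) = agreeUpTo-splice i (shift 1 p) s j j<i

shift-splice : ∀ i (p s : Seq X) → shift i (splice i p s) ≗ s
shift-splice zero    p s j = refl
shift-splice (suc i) p s j = shift-splice i (shift 1 p) s j

++ˢ-extends : ∀ (w : List X) s → Extends (w ++ˢ s) w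
++ˢ-extends (x ∷ w) s fzero    = refl
++ˢ-extends (x ∷ w) s (fsuc j) = ++ˢ-extends w s j

extends-resp-agreeUpTo : ∀ {w : List X} → AgreeUpTo (length w) a b →
                         Extends a w → Extends b w
extends-resp-agreeUpTo a≈b a⊒w j = trans (sym (a≈b (toℕ j) (toℕ<n j))) (a⊒w j)

extends-applyUpTo : ∀ l {s : Seq X} → Extends a (applyUpTo s l) → AgreeUpTo l a s
extends-applyUpTo (suc l) a⊒s zero    _         = a⊒s fzero
extends-applyUpTo (suc l) a⊒s (suc j) (s≤s j<l) =
  extends-applyUpTo l (λ j′ → a⊒s (fsuc j′)) j j<l

isOpen-cylinder : ∀ n (x : Seq X) → IsOpen (AgreeUpTo n x)
isOpen-cylinder n x a x≈a = n , λ b a≈b → agreeUpTo-trans x≈a a≈b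

closure-extends : ∀ {A : Subset X} {w : List X} → Closure A b → Extends (shift i b) w →
                  ∃ λ a → A a × Extends (shift i a) w
closure-extends {b = b} {i = i} {w = w} b∈closure b-extends
  with a , a∈A , b≈a ← b∈closure (i + length w)
  = a , a∈A , extends-resp-agreeUpTo {w = w} (agreeUpTo-shift i b≈a) b-extends

splice-extends : ∀ i (x : Seq X) w → Extends (shift i (splice i x (w ++ˢ x))) w
splice-extends i x w j = trans (shift-splice i x _ (toℕ j)) (++ˢ-extends w x j)

MissesAfter : (ℕ → List X) → ℕ → Subset X
MissesAfter f m a = ¬ ∃ λ i → m ≤ i × Extends (shift i a) (f i)

missesAfter-nowhereDense : ∀ (f : ℕ → List X) m → NowhereDense (MissesAfter f m)
missesAfter-nowhereDense f m U U-open U⊆closure x x∈U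
  with n , cylinder⊆U ← U-open x x∈U =
  let i = n + m
      b = splice i x (f i ++ˢ x)
      b∈U = cylinder⊆U b (agreeUpTo-weaken (m≤m+n n m) (agreeUpTo-splice i x _))
      a , a-misses , a-extends =
        closure-extends {w = f i} (U⊆closure b b∈U) (splice-extends i x (f i))
  in a-misses (i , m≤n+m m n , a-extends)

Window : Set → Set
Window X = Seq X × ℕ

Matches : ℕ → Window X → Subset X
Matches i (s , l) a = AgreeUpTo l (shift i a) s

_≼_ : Window X → Window X → Set
(s , l) ≼ (s′ , l′) = l ≤ l′ × AgreeUpTo l s s′

≼-refl : {W : Window X} → W ≼ W
≼-refl = ≤-refl , λ _ _ → refl

≼-trans : {W₁ W₂ W₃ : Window X} → W₁ ≼ W₂ → W₂ ≼ W₃ → W₁ ≼ W₃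
≼-trans (l₁≤l₂ , s₁≈s₂) (l₂≤l₃ , s₂≈s₃) =
  ≤-trans l₁≤l₂ l₂≤l₃ , agreeUpTo-trans s₁≈s₂ (agreeUpTo-weaken l₁≤l₂ s₂≈s₃)

matches-antitone : ∀ {W W′ : Window X} → W ≼ W′ → Matches i W′ ⊆ Matches i W
matches-antitone (l≤l′ , s≈s′) a a≈s′ =
  agreeUpTo-trans (agreeUpTo-weaken l≤l′ a≈s′) (agreeUpTo-sym s≈s′)

Enforceable : ℕ → Subset X → Set
Enforceable i P = ∀ W → ∃ λ W′ → W ≼ W′ × Matches i W′ ⊆ P

enforceable-all : ∀ {I : Set} (P : I → Subset X) → (∀ r → Enforceable i (P r)) →
                  ∀ rs → Enforceable i (λ a → ∀ r → r ∈ rs → P r a)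
enforceable-all P enforce [] W = W , ≼-refl , λ _ _ _ ()
enforceable-all {i = i} P enforce (r ∷ rs) W
  with W₁ , W≼W₁ , W₁⊆P ← enforce r W
  with W₂ , W₁≼W₂ , W₂⊆Ps ← enforceable-all P enforce rs W₁
  = W₂ , ≼-trans W≼W₁ W₁≼W₂ , W₂⊆P
  where
  W₂⊆P : Matches i W₂ ⊆ (λ a → ∀ r′ → r′ ∈ r ∷ rs → P r′ a)
  W₂⊆P a a∈W₂ _ (here refl)  = W₁⊆P a (matches-antitone W₁≼W₂ a a∈W₂)
  W₂⊆P a a∈W₂ r′ (there r′∈) = W₂⊆Ps a a∈W₂ r′ r′∈

-- A prefix of length i is encoded as a sequence whose terms from position i on are irrelevant.
prefixes : X → List X → ℕ → List (Seq X)
prefixes x₀ allX zero    = [ (λ _ → x₀) ]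
prefixes x₀ allX (suc i) =
  cartesianProductWith (λ x p → [ x ] ++ˢ p) allX (prefixes x₀ allX i)

prefixes-cover : ∀ (x₀ : X) {allX} → (∀ x → x ∈ allX) →
                 ∀ i a → ∃ λ p → p ∈ prefixes x₀ allX i × AgreeUpTo i a p
prefixes-cover x₀ ∈-allX zero    a = _ , here refl , λ _ ()
prefixes-cover x₀ ∈-allX (suc i) a
  with p , p∈prefixes , tail≈p ← prefixes-cover x₀ ∈-allX i (shift 1 a)
  = [ a 0 ] ++ˢ p , ∈-cartesianProductWith⁺ _ (∈-allX (a 0)) p∈prefixes , a≈
  where
  a≈ : AgreeUpTo (suc i) a ([ a 0 ] ++ˢ p)
  a≈ zero    _         = refl
  a≈ (suc j) (s≤s j<i) = tail≈p j j<i

module Classical (dne : DoubleNegationElimination 0ℓ) where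

  nowhereDense-avoid : ∀ {A : Subset X} → NowhereDense A → ∀ x L →
    ∃₂ λ y M → AgreeUpTo L x y × (∀ b → AgreeUpTo M y b → ¬ A b)
  nowhereDense-avoid A-nd x L = dne λ no-avoid →
    A-nd (AgreeUpTo L x) (isOpen-cylinder L x)
      (λ z x≈z n → dne λ z-isolated →
        no-avoid (z , n , x≈z , λ b z≈b b∈A → z-isolated (b , b∈A , z≈b)))
      x (λ _ _ → refl)

  enforceable-avoid : ∀ {A : Subset X} → NowhereDense A → ∀ i p →
                      Enforceable i (λ a → AgreeUpTo i a p → ¬ A a)
  enforceable-avoid {A = A} A-nd i p (s , l) with nowhereDense-avoid A-nd (splice i p s) (i + l)
  ... | y , M , spliced≈y , y-avoids = (shift i y , l + M) , (m≤m+n l M , s≈y) , avoids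
    where
    s≈y : AgreeUpTo l s (shift i y)
    s≈y j j<l = trans (sym (shift-splice i p s j)) (agreeUpTo-shift i spliced≈y j j<l)
    avoids : Matches i (shift i y , l + M) ⊆ (λ a → AgreeUpTo i a p → ¬ A a)
    avoids a a≈y a≈p =
      y-avoids a (agreeUpTo-sym (agreeUpTo-weaken M≤ (agreeUpTo-+ i a≈y↾i a≈y)))
      where
      M≤ : M ≤ i + (l + M)
      M≤ = ≤-trans (m≤n+m M l) (m≤n+m (l + M) i)
      a≈y↾i : AgreeUpTo i a y
      a≈y↾i = agreeUpTo-trans a≈p
                (agreeUpTo-trans (agreeUpTo-splice i p s)
                  (agreeUpTo-weaken (m≤m+n i l) spliced≈y))

  secondCategory⇒condition2 : (S : Subset X) → SecondCategory S → Condition2 S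
  secondCategory⇒condition2 S S-second f = dne λ no-point →
    S-second (MissesAfter f , missesAfter-nowhereDense f , λ a a∈S → dne λ never-misses →
      no-point (a , a∈S , λ m → dne λ misses → never-misses (m , misses)))

  module _ (x₀ : X) (allX : List X) (∈-allX : ∀ x → x ∈ allX) where

    avoiding-word : (N : ℕ → Subset X) → (∀ k → NowhereDense (N k)) → ∀ i →
                    ∃ λ w → ∀ a → Extends (shift i a) w → ∀ k → k ≤ i → ¬ N k a
    avoiding-word N N-nd i
      with (s , l) , _ , window-avoids ←
             enforceable-all (λ (p , k) a → AgreeUpTo i a p → ¬ N k a)
               (λ (p , k) → enforceable-avoid (N-nd k) i p)
               (cartesianProduct (prefixes x₀ allX i) (upTo (suc i))) ((λ _ → x₀) , 0)
      = applyUpTo s l , avoids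
      where
      avoids : ∀ a → Extends (shift i a) (applyUpTo s l) → ∀ k → k ≤ i → ¬ N k a
      avoids a a-extends k k≤i with p , p∈prefixes , a≈p ← prefixes-cover x₀ ∈-allX i a
        = window-avoids a (extends-applyUpTo l a-extends) (p , k)
            (∈-cartesianProduct⁺ p∈prefixes (∈-upTo⁺ (s≤s k≤i))) a≈p

    condition2⇒secondCategory : (S : Subset X) → Condition2 S → SecondCategory S
    condition2⇒secondCategory S S-cond2 (N , N-nd , S⊆⋃N) =
      let a , a∈S , a-hits = S-cond2 (λ i → proj₁ (avoiding-word N N-nd i))
          k , a∈Nk = S⊆⋃N a a∈S
          i , k≤i , a-extends = a-hits k
      in proj₂ (avoiding-word N N-nd i) a a-extends k k≤i a∈Nk

mainTheorem1 : ExcludedMiddle 0ℓ → (X : Set) → (k : ℕ) → X ↔ Fin (suc k) →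
    (S : Subset X) → SecondCategory S ⇔ Condition2 S
mainTheorem1 em X k X↔Fin S =
  mk⇔ (secondCategory⇒condition2 S) (condition2⇒secondCategory (from fzero) allX ∈-allX S)
  where
  open Inverse X↔Fin using (to; from; strictlyInverseʳ)
  open Classical (em⇒dne em)
  allX : List X
  allX = map from (allFin (suc k))
  ∈-allX : ∀ x → x ∈ allX
  ∈-allX x = subst (_∈ allX) (strictlyInverseʳ x) (∈-map⁺ from (∈-allFin (to x)))
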